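{- For all integers $t \geq 3$ and $k \geq 1$, $$gr_{k}(K_{3}:S_{t}^{+})\geq\begin{cases}2(t-1)\cdot5^{\frac{k-2}{2}}+1 & \text{ if $k$ is even,}\\ (t-1)\cdot5^{\frac{k-1}{2}}+1 & \text{ if $k$ is odd.}\end{cases}$$
   Context: For $t \geq 3$, $S_t$ denotes the star with $t$ vertices, and $S_t^{+}$ denotes the graph obtained from $S_t$ by adding one edge between two of its pendant vertices (forming a triangle). A coloring of the edges of a graph is rainbow if no two edges receive the same color. For a positive integer $k$ and a graph $H$, the Gallai-Ramsey number $gr_k(K_3:H)$ is the minimum integer $m$ such that every coloring of the edges of the complete graph $K_m$ using at most $k$ colors contains either a rainbow triangle or a monochromatic copy of $H$. -}

module Defs where

open import Data.Nat using (ℕ; zero; suc; _+_; _*_; _∸_; _^_; _≤_; _/_; _%_)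
open import Data.Fin using (Fin) renaming (zero to f0; suc to fs)
open import Data.Product using (Σ; ∃; _×_; _,_)
open import Relation.Nullary using (¬_)
open import Relation.Binary.PropositionalEquality using (_≡_; _≢_)
open import Function.Definitions using (Injective)

-- An edge colouring of the complete graph K_m with (at most) k colours:
-- a symmetric function on pairs of vertices; values on the diagonal are irrelevant.
record Colouring (m k : ℕ) : Set where
  field
    col : Fin m → Fin m → Fin k
    sym : ∀ i j → col i j ≡ col j i
open Colouring public

RainbowTriangle : ∀ {m k} → Colouring m k → Set
RainbowTriangle {m} c =
  Σ (Fin m) λ a → Σ (Fin m) λ b → Σ (Fin m) λ d →
    (a ≢ b) × (b ≢ d) × (a ≢ d) ×
    (col c a b ≢ col c b d) × (col c b d ≢ col c a d) × (col c a b ≢ col c a d)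

-- S_t^+ on vertex set Fin t: centre f0 adjacent to all other vertices,
-- plus the extra edge between the pendant vertices 1 and 2 (needs t ≥ 3).
MonoStarPlus : ∀ {m k} → Colouring m k → (t : ℕ) → Set
MonoStarPlus {m} {k} c t =
  Σ (Fin k) λ x → Σ (Fin (3 + t) → Fin m) λ f →
    Injective _≡_ _≡_ f ×
    (∀ (i : Fin (2 + t)) → col c (f f0) (f (fs i)) ≡ x) ×
    (col c (f (fs f0)) (f (fs (fs f0))) ≡ x)

-- K_m →_k (rainbow K_3 or monochromatic S_t^+), for t ≥ 3 (t = s + 3)
Arrows : (k s m : ℕ) → Set
Arrows k s m = ∀ (c : Colouring m k) → RainbowTriangle c ⊎' MonoStarPlus c s
  where
  open import Data.Sum using () renaming (_⊎_ to _⊎'_)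

bound : (t k : ℕ) → ℕ
bound t k = sel (k % 2)
  where
  sel : ℕ → ℕ
  sel zero    = 2 * (t ∸ 1) * 5 ^ ((k ∸ 2) / 2) + 1
  sel (suc _) = (t ∸ 1) * 5 ^ ((k ∸ 1) / 2) + 1

module Submission where

-- A lower bound  gr_k ≥ N + 1  means exhibiting a k-colouring of K_N with no
-- rainbow triangle and no monochromatic S_t^+.  We build such colourings by
-- substitution ("blow-up"): replace every vertex of a small template colouring
-- T (fresh colours, no rainbow and no monochromatic triangle) by a copy of a
-- good colouring G.  Edges inside a copy keep G's colour, edges between copies
-- get T's colour.  A monochromatic S_t^+ in an old colour lives inside one copy,
-- and one in a new colour contains a triangle, which projects onto a
-- monochromatic triangle of T; rainbow triangles are excluded similarly.
--
-- Starting from one colour on K_{t-1} (odd k) or two colours on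
-- K_{2(t-1)} (even k), and blowing up r times by the pentagon colouring of K₅
-- (two colours, no monochromatic triangle), gives k = 1 + 2r resp. 2 + 2r colours
-- on (t-1)·5^r resp. 2(t-1)·5^r vertices, which is exactly the claimed bound.

open import Defs hiding (sym)
open import Data.Nat using (ℕ; _≤_; _+_)
open import Data.Nat as ℕ using (zero; suc; _*_; _∸_; _^_; _<_; z≤n; s≤s)
open import Data.Nat.Properties
  using (≤-trans; ≤-reflexive; +-comm; +-assoc; *-comm; *-assoc; *-identityʳ; +-identityʳ; +-∸-assoc; n≮n; ≰⇒>)
open import Data.Nat.DivMod using ([m+kn]%n≡m%n; m*n/n≡m)
open import Data.Fin using (Fin; toℕ; splitAt; join; remQuot; combine; inject≤)
  renaming (zero to f0; suc to fs)
open import Data.Fin.Properties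
  using (_≟_; all?; splitAt-join; combine-remQuot; inject≤-injective; injective⇒≤)
open import Data.Product using (_×_; _,_; proj₁; proj₂; uncurry)
open import Data.Sum using (_⊎_; inj₁; inj₂)
open import Data.Sum.Properties using (inj₁-injective; inj₂-injective)
open import Data.Empty using (⊥; ⊥-elim)
open import Function using (_∘_)
open import Function.Definitions using (Injective)
open import Relation.Nullary using (¬_; Dec; yes; no)
open import Relation.Nullary.Decidable using (from-yes; ¬?; _×-dec_; _→-dec_)
open import Relation.Binary.Definitions using (DecidableEquality)
open import Relation.Binary.PropositionalEquality
  using (_≡_; _≢_; refl; sym; trans; cong; cong₂; subst; subst₂; module ≡-Reasoning)

Distinct₃ : {A : Set} → A → A → A → Set
Distinct₃ x y z = x ≢ y × y ≢ z × x ≢ z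

distinct₃-image : ∀ {A B : Set} {f : A → B} {x y z : A} →
  Injective _≡_ _≡_ f → Distinct₃ x y z → Distinct₃ (f x) (f y) (f z)
distinct₃-image f-inj (x≢y , y≢z , x≢z) = x≢y ∘ f-inj , y≢z ∘ f-inj , x≢z ∘ f-inj

distinct₃-preimage : ∀ {A B : Set} (f : A → B) {x y z : A} →
  Distinct₃ (f x) (f y) (f z) → Distinct₃ x y z
distinct₃-preimage f (fx≢fy , fy≢fz , fx≢fz) =
  fx≢fy ∘ cong f , fy≢fz ∘ cong f , fx≢fz ∘ cong f

distinct₃? : ∀ {A : Set} → DecidableEquality A → ∀ x y z → Dec (Distinct₃ {A} x y z)
distinct₃? _≟ᴬ_ x y z = ¬? (x ≟ᴬ y) ×-dec ¬? (y ≟ᴬ z) ×-dec ¬? (x ≟ᴬ z)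

-- Pigeonhole for triples: a two-element set has no three distinct elements.
-- This makes every 2-colouring rainbow-free and K₂ triangle-free.
noDistinct₃-Fin2 : ∀ (x y z : Fin 2) → ¬ Distinct₃ x y z
noDistinct₃-Fin2 = from-yes (all? λ (x : Fin 2) → all? λ y → all? λ z → ¬? (distinct₃? _≟_ x y z))

record GallaiColouring (V C : Set) : Set where
  field
    colour      : V → V → C
    symmetric   : ∀ u v → colour u v ≡ colour v u
    rainbowFree : ∀ u v w → Distinct₃ u v w →
                  ¬ Distinct₃ (colour u v) (colour v w) (colour u w)
open GallaiColouring

MonoTriangleFree : ∀ {V C} → GallaiColouring V C → Set
MonoTriangleFree {C = C} G =
  ∀ u v w → Distinct₃ u v w → ∀ (x : C) →
  colour G u v ≡ x → colour G v w ≡ x → colour G u w ≡ x → ⊥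

StarPlusFree : ∀ {V C} → ℕ → GallaiColouring V C → Set
StarPlusFree {V} {C} s G =
  ∀ (x : C) (f : Fin (3 + s) → V) → Injective _≡_ _≡_ f →
  (∀ (i : Fin (2 + s)) → colour G (f f0) (f (fs i)) ≡ x) →
  colour G (f (fs f0)) (f (fs (fs f0))) ≡ x → ⊥

record Template (P D : Set) : Set where
  field
    gallai           : GallaiColouring P D
    monoTriangleFree : MonoTriangleFree gallai

record StarPlusAvoiding (s : ℕ) (V C : Set) : Set where
  field
    gallai       : GallaiColouring V C
    starPlusFree : StarPlusFree s gallai

restrict : ∀ {s V W C} (g : W → V) → Injective _≡_ _≡_ g →
  StarPlusAvoiding s V C → StarPlusAvoiding s W C
restrict {s} {W = W} {C} g g-inj A = record { gallai = G′ ; starPlusFree = noStar }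
  where
  open StarPlusAvoiding A
  G′ : GallaiColouring W C
  G′ = record
    { colour      = λ u v → colour gallai (g u) (g v)
    ; symmetric   = λ u v → symmetric gallai (g u) (g v)
    ; rainbowFree = λ u v w → rainbowFree gallai (g u) (g v) (g w) ∘ distinct₃-image g-inj
    }
  noStar : StarPlusFree s G′
  noStar x f f-inj = starPlusFree x (g ∘ f) (f-inj ∘ g-inj)

recolour : ∀ {s V C D} (ι : C → D) → Injective _≡_ _≡_ ι →
  StarPlusAvoiding s V C → StarPlusAvoiding s V D
recolour {s} {V} {D = D} ι ι-inj A = record { gallai = G′ ; starPlusFree = noStar }
  where
  open StarPlusAvoiding A
  G′ : GallaiColouring V D
  G′ = record
    { colour      = λ u v → ι (colour gallai u v)
    ; symmetric   = λ u v → cong ι (symmetric gallai u v)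
    ; rainbowFree = λ u v w uvw → rainbowFree gallai u v w uvw ∘ distinct₃-preimage ι
    }
  -- a star monochromatic after renaming has the colour of its extra edge before
  noStar : StarPlusFree s G′
  noStar x f f-inj star extra =
    starPlusFree (colour gallai (f (fs f0)) (f (fs (fs f0)))) f f-inj
      (λ i → ι-inj (trans (star i) (sym extra))) refl

module BlowUp {V C P D : Set} (_≟ᴾ_ : DecidableEquality P)
              (G : GallaiColouring V C) (T : GallaiColouring P D) where

  blockColour : ∀ {i j : P} → Dec (i ≡ j) → V → V → C ⊎ D
  blockColour         (yes _) u v = inj₁ (colour G u v)
  blockColour {i} {j} (no _) u v = inj₂ (colour T i j)

  blown : P × V → P × V → C ⊎ D
  blown (i , u) (j , v) = blockColour (i ≟ᴾ j) u v

  oldColour : ∀ a b {y} → blown a b ≡ inj₁ y →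
    proj₁ a ≡ proj₁ b × colour G (proj₂ a) (proj₂ b) ≡ y
  oldColour (i , u) (j , v) e with i ≟ᴾ j
  ... | yes i≡j = i≡j , inj₁-injective e
  ... | no _    with () ← e

  newColour : ∀ a b {y} → blown a b ≡ inj₂ y →
    proj₁ a ≢ proj₁ b × colour T (proj₁ a) (proj₁ b) ≡ y
  newColour (i , u) (j , v) e with i ≟ᴾ j
  ... | yes _   with () ← e
  ... | no i≢j  = i≢j , inj₂-injective e

  -- A triangle meets one, two or three blocks.  Within one block it is a triangle
  -- of G; across three blocks it projects to a triangle of T; in the middle case
  -- two of its edges run between the same two blocks and so share a colour.
  blown-rainbowFree : ∀ a b d → Distinct₃ a b d →
    ¬ Distinct₃ (blown a b) (blown b d) (blown a d)
  blown-rainbowFree (i , u) (j , v) (l , w) abd with i ≟ᴾ j | j ≟ᴾ l | i ≟ᴾ l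
  ... | yes refl | yes refl | yes _ =
    rainbowFree G u v w (distinct₃-preimage (i ,_) abd) ∘ distinct₃-preimage inj₁
  ... | yes refl | yes refl | no i≢i  = ⊥-elim (i≢i refl)
  ... | yes refl | no j≢l   | yes refl = ⊥-elim (j≢l refl)
  ... | no i≢j   | yes refl | yes refl = ⊥-elim (i≢j refl)
  ... | yes refl | no _     | no _     = λ (_ , bd≢ad , _) → bd≢ad refl
  ... | no _     | yes refl | no _     = λ (_ , _ , ab≢ad) → ab≢ad refl
  ... | no _     | no _     | yes refl = λ (ab≢bd , _) → ab≢bd (cong inj₂ (symmetric T i j))
  ... | no i≢j   | no j≢l   | no i≢l   =
    rainbowFree T i j l (i≢j , j≢l , i≢l) ∘ distinct₃-preimage inj₂

  blownGallai : GallaiColouring (P × V) (C ⊎ D)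
  blownGallai = record
    { colour      = blown
    ; symmetric   = blown-symmetric
    ; rainbowFree = blown-rainbowFree
    }
    where
    blown-symmetric : ∀ a b → blown a b ≡ blown b a
    blown-symmetric (i , u) (j , v) with i ≟ᴾ j | j ≟ᴾ i
    ... | yes refl | yes _    = cong inj₁ (symmetric G u v)
    ... | yes refl | no i≢i   = ⊥-elim (i≢i refl)
    ... | no i≢i   | yes refl = ⊥-elim (i≢i refl)
    ... | no _     | no _     = cong inj₂ (symmetric T i j)

  -- A monochromatic S^+ in an old colour lies in a single block, hence is one of G;
  -- one in a new colour has its triangle spread over three blocks, giving a
  -- monochromatic triangle of T.
  blown-starPlusFree : ∀ {s} → StarPlusFree s G → MonoTriangleFree T → StarPlusFree s blownGallai
  blown-starPlusFree noStar _ (inj₁ y) f f-inj star extra =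
    noStar y (proj₂ ∘ f) inner-inj
      (λ i → proj₂ (oldColour _ _ (star i))) (proj₂ (oldColour _ _ extra))
    where
    centreBlock : ∀ j → proj₁ (f j) ≡ proj₁ (f f0)
    centreBlock f0     = refl
    centreBlock (fs j) = sym (proj₁ (oldColour _ _ (star j)))
    inner-inj : Injective _≡_ _≡_ (proj₂ ∘ f)
    inner-inj {i} {j} e = f-inj (cong₂ _,_ (trans (centreBlock i) (sym (centreBlock j))) e)
  blown-starPlusFree _ noTriangle (inj₂ y) f f-inj star extra =
    noTriangle (proj₁ (f f0)) (proj₁ (f (fs f0))) (proj₁ (f (fs (fs f0))))
      (proj₁ e01 , proj₁ e12 , proj₁ e02) y (proj₂ e01) (proj₂ e12) (proj₂ e02)
    where
    e01 = newColour _ _ (star f0)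
    e12 = newColour _ _ extra
    e02 = newColour _ _ (star (fs f0))

blowUp : ∀ {s V C P D} → DecidableEquality P →
  Template P D → StarPlusAvoiding s V C → StarPlusAvoiding s (P × V) (C ⊎ D)
blowUp _≟ᴾ_ T A = record
  { gallai       = blownGallai
  ; starPlusFree = blown-starPlusFree (starPlusFree A) (Template.monoTriangleFree T)
  }
  where
  open StarPlusAvoiding using (gallai; starPlusFree)
  open BlowUp _≟ᴾ_ (gallai A) (Template.gallai T)

GoodFin : ℕ → ℕ → ℕ → Set
GoodFin s n k = StarPlusAvoiding s (Fin n) (Fin k)

-- The blow-up on finite vertex and colour sets: Fin p × Fin n ≅ Fin (p * n) and
-- Fin k ⊎ Fin q ≅ Fin (k + q).
blowUpFin : ∀ {s n k p q} → Template (Fin p) (Fin q) → GoodFin s n k → GoodFin s (p * n) (k + q)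
blowUpFin {n = n} {k} {p} {q} T A =
  recolour (join k q) join-injective (restrict (remQuot n) remQuot-injective (blowUp _≟_ T A))
  where
  join-injective : Injective _≡_ _≡_ (join k q)
  join-injective {x} {y} e =
    trans (sym (splitAt-join k q x))
          (trans (cong (splitAt k) e) (splitAt-join k q y))
  remQuot-injective : Injective _≡_ _≡_ (remQuot {p} n)
  remQuot-injective {i} {j} e =
    trans (sym (combine-remQuot {p} n i)) (trans (cong (uncurry combine) e) (combine-remQuot {p} n j))

-- One colour on every edge: rainbow-free, and on fewer than s + 3 vertices
-- there is no room for S_{s+3}^+.
monochromatic : ∀ V → GallaiColouring V (Fin 1)
monochromatic V = record
  { colour      = λ _ _ → f0
  ; symmetric   = λ _ _ → refl
  ; rainbowFree = λ _ _ _ _ (c≢c , _) → c≢c refl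
  }

smallMonochromatic : ∀ {s n} → n < 3 + s → GoodFin s n 1
smallMonochromatic {n = n} n<3+s = record
  { gallai       = monochromatic (Fin n)
  ; starPlusFree = λ _ f f-inj _ _ → n≮n n (≤-trans n<3+s (injective⇒≤ f-inj))
  }

oneColourClique : ∀ s → GoodFin s (s + 2) 1
oneColourClique s = smallMonochromatic (s≤s (≤-reflexive (+-comm s 2)))

edgeTemplate : Template (Fin 2) (Fin 1)
edgeTemplate = record
  { gallai           = monochromatic (Fin 2)
  ; monoTriangleFree = λ u v w uvw _ _ _ _ → noDistinct₃-Fin2 u v w uvw
  }

-- The 2-colouring of K₅ whose colour classes are the two 5-cycles: ij gets
-- colour 0 iff i − j ≡ ±1 (mod 5).  Neither 5-cycle contains a triangle.
pentagonColour : Fin 5 → Fin 5 → Fin 2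
pentagonColour i j with (5 + toℕ i ∸ toℕ j) ℕ.% 5
... | 1 = f0
... | 4 = f0
... | _ = fs f0

pentagonTemplate : Template (Fin 5) (Fin 2)
pentagonTemplate = record
  { gallai = record
    { colour      = pentagonColour
    ; symmetric   = from-yes (all? λ (i : Fin 5) → all? λ j → pentagonColour i j ≟ pentagonColour j i)
    ; rainbowFree = λ _ _ _ _ → noDistinct₃-Fin2 _ _ _
    }
  ; monoTriangleFree = λ u v w uvw _ uv vw uw →
      pentagon-triangleFree u v w uvw (trans uv (sym vw) , trans vw (sym uw))
  }
  where
  pentagon-triangleFree : ∀ u v w → Distinct₃ u v w →
    ¬ (pentagonColour u v ≡ pentagonColour v w × pentagonColour v w ≡ pentagonColour u w)
  pentagon-triangleFree = from-yes (all? λ (u : Fin 5) → all? λ v → all? λ w →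
    distinct₃? _≟_ u v w →-dec
      (¬? ((pentagonColour u v ≟ pentagonColour v w) ×-dec (pentagonColour v w ≟ pentagonColour u w))))

iteratePentagon : ∀ {s n k} r → GoodFin s n k → GoodFin s (n * 5 ^ r) (k + r * 2)
iteratePentagon {s} {n} {k} zero A =
  subst₂ (GoodFin s) (sym (*-identityʳ n)) (sym (+-identityʳ k)) A
iteratePentagon {s} {n} {k} (suc r) A =
  subst₂ (GoodFin s) vertices colours (blowUpFin pentagonTemplate (iteratePentagon r A))
  where
  vertices : 5 * (n * 5 ^ r) ≡ n * 5 ^ suc r
  vertices = begin
    5 * (n * 5 ^ r)  ≡⟨ sym (*-assoc 5 n (5 ^ r)) ⟩
    5 * n * 5 ^ r    ≡⟨ cong (_* 5 ^ r) (*-comm 5 n) ⟩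
    n * 5 * 5 ^ r    ≡⟨ *-assoc n 5 (5 ^ r) ⟩
    n * 5 ^ suc r    ∎
    where open ≡-Reasoning
  colours : k + r * 2 + 2 ≡ k + suc r * 2
  colours = trans (+-assoc k (r * 2) 2) (cong (k +_) (+-comm (r * 2) 2))

noArrow : ∀ {s k m} → GoodFin s m k → ¬ Arrows k s m
noArrow {k = k} {m} A arrows with arrows colouring
  where
  colouring : Colouring m k
  colouring = record
    { col = colour (StarPlusAvoiding.gallai A)
    ; sym = symmetric (StarPlusAvoiding.gallai A) }
... | inj₁ (a , b , d , a≢b , b≢d , a≢d , rainbow) =
  rainbowFree (StarPlusAvoiding.gallai A) a b d (a≢b , b≢d , a≢d) rainbow
... | inj₂ (x , f , f-inj , star , extra) = StarPlusAvoiding.starPlusFree A x f f-inj star extra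

refute : ∀ {s k m N} → m ≤ N → GoodFin s N k → ¬ Arrows k s m
refute m≤N = noArrow ∘ restrict (λ i → inject≤ i m≤N) (inject≤-injective m≤N m≤N _ _)

exceeds : ∀ {s k m N} → GoodFin s N k → Arrows k s m → suc N ≤ m
exceeds A arrows = ≰⇒> λ m≤N → refute m≤N A arrows

data PositiveParity : ℕ → Set where
  odd  : ∀ r → PositiveParity (1 + r * 2)
  even : ∀ r → PositiveParity (2 + r * 2)

parity : ∀ k → 1 ≤ k → PositiveParity k
parity (suc zero)    _ = odd 0
parity (suc (suc k)) _ with parity (suc k) (s≤s z≤n)
... | odd r  = even r
... | even r = odd (suc r)

remainder : ∀ a r → (a + r * 2) ℕ.% 2 ≡ a ℕ.% 2
remainder a r = [m+kn]%n≡m%n a r 2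

half : ∀ r → r * 2 ℕ./ 2 ≡ r
half r = m*n/n≡m r 2

predecessor : ∀ s → s + 3 ∸ 1 ≡ s + 2
predecessor s = +-∸-assoc s (s≤s z≤n)

bound-odd : ∀ s r → bound (s + 3) (1 + r * 2) ≡ suc ((s + 2) * 5 ^ r)
bound-odd s r rewrite remainder 1 r | half r | predecessor s = +-comm _ 1

bound-even : ∀ s r → bound (s + 3) (2 + r * 2) ≡ suc (2 * (s + 2) * 5 ^ r)
bound-even s r rewrite remainder 2 r | half r | predecessor s = +-comm _ 1

-- Odd k = 1 + 2r: blow up one colour on K_{t-1} r times.  Even k = 2 + 2r: blow up
-- first by K₂ (giving two colours on K_{2(t-1)}), then r times by the pentagon.
lemma7 : ∀ (s k : ℕ) → 1 ≤ k →
    ∀ (m : ℕ) → Arrows k s m → bound (s + 3) k ≤ m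
lemma7 s k 1≤k m arrows with parity k 1≤k
... | odd r  = subst (_≤ m) (sym (bound-odd s r)) (exceeds (iteratePentagon r base) arrows)
  where
  base : GoodFin s (s + 2) 1
  base = oneColourClique s
... | even r = subst (_≤ m) (sym (bound-even s r)) (exceeds (iteratePentagon r base) arrows)
  where
  base : GoodFin s (2 * (s + 2)) 2
  base = blowUpFin edgeTemplate (oneColourClique s)
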